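{- If $N$ is a friend of $10$, then $N$ has a prime factor $p$ with $p\equiv 1\pmod 6$.
   Context: For a positive integer $n$, $\sigma(n)$ denotes the sum of the positive divisors of $n$ and $I(n)=\sigma(n)/n$. A positive integer $N>10$ is called a friend of $10$ if $I(N)=9/5$. -}

module Defs where

open import Data.Nat using (ℕ; suc; _*_; _<_)
open import Data.Nat.Divisibility using (_∣?_)
open import Data.Nat.ListAction using (sum)
open import Data.List using (List; filter; upTo; map)
open import Data.Product using (_×_)
open import Relation.Binary.PropositionalEquality using (_≡_)

divisors : ℕ → List ℕ
divisors n = filter (_∣? n) (map suc (upTo n))

σ : ℕ → ℕ
σ n = sum (divisors n)

-- N is a friend of 10: N > 10 and I(N) = σ(N)/N = 9/5,
-- stated cross-multiplied as 5·σ(N) = 9·N (equivalent since N > 0)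
FriendOf10 : ℕ → Set
FriendOf10 N = (10 < N) × (5 * σ N ≡ 9 * N)

{-# OPTIONS --safe #-}
module Submission where

-- An even friend N of 10 is also divisible by 5, so N = 10k with k > 1; then
-- σ(N) ≥ 1 + k σ(10) = 1 + 18k > 9N/5, so N is odd.  If no prime factor of N
-- were ≡ 1 (mod 6), each would be ≡ 3 or 5 (mod 6), and the recursion
-- σ(p^(e+1)) = 1 + p σ(p^e) shows that σ(p^e) is even or ≡ 1 (mod 6).  These
-- residues are closed under products and σ is multiplicative, so σ(N) would be
-- even or ≡ 1 (mod 6).  But 5 σ(N) = 9 N with N odd makes σ(N) odd and
-- divisible by 3.

open import Defs

open import Data.Empty using (⊥-elim)
open import Data.List using (List; []; _∷_; _++_; map; upTo)
open import Data.List.Membership.Propositional using (_∈_)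
open import Data.List.Membership.Propositional.Properties
open import Data.List.Relation.Binary.Permutation.Propositional.Properties using (shift; ∈-resp-↭)
open import Data.List.Relation.Binary.Subset.Propositional using (_⊆_)
open import Data.List.Relation.Unary.All as All using (All; _∷_)
open import Data.List.Relation.Unary.AllPairs using (_∷_)
open import Data.List.Relation.Unary.Any using (here; there)
open import Data.List.Relation.Unary.Unique.Propositional using (Unique)
import Data.List.Relation.Unary.Unique.Propositional.Properties as Unique
open import Data.Nat
open import Data.Nat.Coprimality as Coprime using (Coprime; coprime-divisor)
open import Data.Nat.Divisibility
open import Data.Nat.DivMod using (%-distribˡ-+; %-distribˡ-*; m%n<n)
open import Data.Nat.Induction using (<-rec)
open import Data.Nat.LCM using (lcm-least)
open import Data.Nat.ListAction using (sum)
open import Data.Nat.ListAction.Properties using (sum-++; sum-↭; ∈⇒∣product)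
open import Data.Nat.Primality
  using (Prime; prime?; prime⇒irreducible; prime⇒nonZero; prime⇒nonTrivial; ¬prime[1])
open import Data.Nat.Primality.Factorisation using (factorise)
open import Data.Nat.Properties
open import Data.Product using (_×_; _,_; ∃; ∃₂; proj₂)
open import Data.Sum using (_⊎_; inj₁; inj₂; [_,_]′)
open import Function using (_∘_; id; case_of_)
open import Relation.Binary.PropositionalEquality
open import Relation.Nullary using (¬_; contradiction; yes; no)
open import Relation.Nullary.Decidable using (from-yes; from-no; _×-dec_)

sum-mono-⊆ : ∀ {xs ys : List ℕ} → Unique xs → xs ⊆ ys → sum xs ≤ sum ys
sum-mono-⊆ {[]} _ _ = z≤n
sum-mono-⊆ {x ∷ xs} (x∉xs ∷ !xs) xs⊆ys with ∈-∃++ (xs⊆ys (here refl))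
... | us , vs , refl = begin
  x + sum xs         ≤⟨ +-monoʳ-≤ x (sum-mono-⊆ !xs xs⊆us++vs) ⟩
  x + sum (us ++ vs) ≡⟨ sum-↭ (shift x us vs) ⟨
  sum (us ++ x ∷ vs) ∎
  where
  open ≤-Reasoning
  xs⊆us++vs : xs ⊆ us ++ vs
  xs⊆us++vs y∈xs with ∈-resp-↭ (shift x us vs) (xs⊆ys (there y∈xs))
  ... | here refl = contradiction refl (All.lookup x∉xs y∈xs)
  ... | there y∈us++vs = y∈us++vs

sum-map-*ˡ : ∀ k (xs : List ℕ) → sum (map (k *_) xs) ≡ k * sum xs
sum-map-*ˡ k [] = sym (*-zeroʳ k)
sum-map-*ˡ k (x ∷ xs) = begin
  k * x + sum (map (k *_) xs) ≡⟨ cong (k * x +_) (sum-map-*ˡ k xs) ⟩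
  k * x + k * sum xs          ≡⟨ *-distribˡ-+ k x (sum xs) ⟨
  k * (x + sum xs)            ∎
  where open ≡-Reasoning

divisors-unique : ∀ n → Unique (divisors n)
divisors-unique n = Unique.filter⁺ (_∣? n) (Unique.map⁺ suc-injective (Unique.upTo⁺ n))

∈-divisors⁻ : ∀ {d n} → d ∈ divisors n → d ∣ n
∈-divisors⁻ {n = n} d∈ = proj₂ (∈-filter⁻ (_∣? n) {xs = map suc (upTo n)} d∈)

∈-divisors⁺ : ∀ {d n} → .{{NonZero n}} → d ∣ n → d ∈ divisors n
∈-divisors⁺ {zero} {n} 0∣n = contradiction (0∣⇒≡0 0∣n) (≢-nonZero⁻¹ n)
∈-divisors⁺ {suc d} {suc n} d∣n = ∈-filter⁺ (_∣? suc n) (∈-map⁺ suc (∈-upTo⁺ (∣⇒≤ d∣n))) d∣n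

σ≡sum : ∀ {n} {ds : List ℕ} → .{{NonZero n}} → Unique ds →
        (∀ {d} → d ∈ ds → d ∣ n) → (∀ {d} → d ∣ n → d ∈ ds) → σ n ≡ sum ds
σ≡sum {n} !ds ds⊆ ⊆ds = ≤-antisym
  (sum-mono-⊆ (divisors-unique n) (⊆ds ∘ ∈-divisors⁻))
  (sum-mono-⊆ !ds (∈-divisors⁺ {n = n} ∘ ds⊆))

prime∤⇒coprime : ∀ {p n} → Prime p → ¬ p ∣ n → Coprime n p
prime∤⇒coprime p-prime p∤n (d∣n , d∣p) with prime⇒irreducible p-prime d∣p
... | inj₁ d≡1 = d≡1
... | inj₂ refl = contradiction d∣n p∤n

prime∤m⇒∣m*n⇒∣n : ∀ {p m n} → Prime p → ¬ p ∣ m → p ∣ m * n → p ∣ n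
prime∤m⇒∣m*n⇒∣n p-prime p∤m = coprime-divisor (Coprime.sym (prime∤⇒coprime p-prime p∤m))

∣p^e*m⇒∣m : ∀ {p d m} → Prime p → ¬ p ∣ d → ∀ e → d ∣ p ^ e * m → d ∣ m
∣p^e*m⇒∣m {d = d} {m} _ _ zero d∣m = subst (d ∣_) (*-identityˡ m) d∣m
∣p^e*m⇒∣m {p} {d} {m} p-prime p∤d (suc e) d∣p*p^e*m =
  ∣p^e*m⇒∣m p-prime p∤d e
    (coprime-divisor (prime∤⇒coprime p-prime p∤d) (subst (d ∣_) (*-assoc p (p ^ e) m) d∣p*p^e*m))

prime-factor : ∀ n → .{{NonTrivial n}} → ∃ λ p → Prime p × p ∣ n
prime-factor n@(suc (suc _)) with factorise n
... | record { factors = p ∷ ps ; isFactorisation = n≡p*Πps ; factorsPrime = p-prime ∷ _ } =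
  p , p-prime , subst (p ∣_) (sym n≡p*Πps) (∈⇒∣product {ns = p ∷ ps} (here refl))

prime-power-split : ∀ {p} → Prime p → ∀ n → .{{NonZero n}} →
                    ∃₂ λ e m → ¬ p ∣ m × n ≡ p ^ e * m
prime-power-split {p} p-prime = <-rec Split split
  where
  Split : ℕ → Set
  Split n = .{{NonZero n}} → ∃₂ λ e m → ¬ p ∣ m × n ≡ p ^ e * m
  split : ∀ n → (∀ {q} → q < n → Split q) → Split n
  split n rec with p ∣? n
  ... | no p∤n = 0 , n , p∤n , sym (*-identityˡ n)
  ... | yes (divides q refl) with rec q<q*p {{q≢0}}
    where
    q≢0 : NonZero q
    q≢0 = m*n≢0⇒m≢0 q
    q<q*p : q < q * p
    q<q*p = m<m*n q p {{q≢0}} (nonTrivial⇒n>1 p {{prime⇒nonTrivial p-prime}})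
  ... | e , m , p∤m , refl = suc e , m , p∤m , trans (*-comm _ p) (sym (*-assoc p (p ^ e) m))

-- The divisors of p * (p ^ e * m) not divisible by p are those of m; the
-- others are p times the divisors of p ^ e * m.
σ-p^[1+e]*m : ∀ {p m} → Prime p → ¬ p ∣ m → .{{NonZero m}} → ∀ e →
              σ (p ^ suc e * m) ≡ σ m + p * σ (p ^ e * m)
σ-p^[1+e]*m {p} {m} p-prime p∤m e = begin
  σ (p * p ^ e * m)                             ≡⟨ cong σ (*-assoc p (p ^ e) m) ⟩
  σ (p * n)                                     ≡⟨ σ≡sum unique sound complete ⟩
  sum (divisors m ++ map (p *_) (divisors n))   ≡⟨ sum-++ (divisors m) _ ⟩
  σ m + sum (map (p *_) (divisors n))           ≡⟨ cong (σ m +_) (sum-map-*ˡ p (divisors n)) ⟩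
  σ m + p * σ n                                 ∎
  where
  open ≡-Reasoning
  n = p ^ e * m
  instance
    p≢0 : NonZero p
    p≢0 = prime⇒nonZero p-prime
    n≢0 : NonZero n
    n≢0 = m*n≢0 (p ^ e) m {{m^n≢0 p e}}
    pn≢0 : NonZero (p * n)
    pn≢0 = m*n≢0 p n
  disjoint : ∀ {d} → ¬ (d ∈ divisors m × d ∈ map (p *_) (divisors n))
  disjoint (d∣m , pd′∈) with ∈-map⁻ (p *_) pd′∈
  ... | d′ , _ , refl = p∤m (∣-trans (m∣m*n d′) (∈-divisors⁻ d∣m))
  unique : Unique (divisors m ++ map (p *_) (divisors n))
  unique = Unique.++⁺ (divisors-unique m)
             (Unique.map⁺ (*-cancelˡ-≡ _ _ p) (divisors-unique n)) disjoint
  sound : ∀ {d} → d ∈ divisors m ++ map (p *_) (divisors n) → d ∣ p * n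
  sound {d} d∈ with ∈-++⁻ (divisors m) d∈
  ... | inj₁ d∈divs-m = ∣-trans (∈-divisors⁻ d∈divs-m) (∣n⇒∣m*n p (n∣m*n (p ^ e)))
  ... | inj₂ d∈p*divs-n with ∈-map⁻ (p *_) d∈p*divs-n
  ... | d′ , d′∈divs-n , refl = *-monoʳ-∣ p (∈-divisors⁻ d′∈divs-n)
  complete : ∀ {d} → d ∣ p * n → d ∈ divisors m ++ map (p *_) (divisors n)
  complete {d} d∣pn with p ∣? d
  ... | no p∤d = ∈-++⁺ˡ (∈-divisors⁺ (∣p^e*m⇒∣m p-prime p∤d (suc e) (subst (d ∣_) (sym (*-assoc p (p ^ e) m)) d∣pn)))
  ... | yes (divides d′ refl) = ∈-++⁺ʳ (divisors m)
          (subst (_∈ map (p *_) (divisors n)) (*-comm p d′)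
            (∈-map⁺ (p *_) (∈-divisors⁺ (*-cancelˡ-∣ p (subst (_∣ p * n) (*-comm d′ p) d∣pn)))))

σ-p^[1+e] : ∀ {p} → Prime p → ∀ e → σ (p ^ suc e) ≡ 1 + p * σ (p ^ e)
σ-p^[1+e] {p} p-prime e = begin
  σ (p ^ suc e)          ≡⟨ cong σ (*-identityʳ (p ^ suc e)) ⟨
  σ (p ^ suc e * 1)      ≡⟨ σ-p^[1+e]*m p-prime p∤1 e ⟩
  1 + p * σ (p ^ e * 1)  ≡⟨ cong (λ x → 1 + p * σ x) (*-identityʳ (p ^ e)) ⟩
  1 + p * σ (p ^ e)      ∎
  where
  open ≡-Reasoning
  p∤1 : ¬ p ∣ 1
  p∤1 p∣1 = ¬prime[1] (subst Prime (∣1⇒≡1 p∣1) p-prime)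

σ-p^e*m : ∀ {p m} → Prime p → ¬ p ∣ m → .{{NonZero m}} → ∀ e →
          σ (p ^ e * m) ≡ σ (p ^ e) * σ m
σ-p^e*m {m = m} _ _ zero = trans (cong σ (*-identityˡ m)) (sym (*-identityˡ (σ m)))
σ-p^e*m {p} {m} p-prime p∤m (suc e) = begin
  σ (p ^ suc e * m)                ≡⟨ σ-p^[1+e]*m p-prime p∤m e ⟩
  σ m + p * σ (p ^ e * m)          ≡⟨ cong (λ x → σ m + p * x) (σ-p^e*m p-prime p∤m e) ⟩
  σ m + p * (σ (p ^ e) * σ m)      ≡⟨ cong (σ m +_) (*-assoc p (σ (p ^ e)) (σ m)) ⟨
  (1 + p * σ (p ^ e)) * σ m        ≡⟨ cong (_* σ m) (σ-p^[1+e] p-prime e) ⟨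
  σ (p ^ suc e) * σ m              ∎
  where open ≡-Reasoning

σ-in-submonoid : (Q : ℕ → Set) → Q 1 → (∀ {a b} → Q a → Q b → Q (a * b)) →
                 ∀ n → .{{NonZero n}} → (∀ {p} → Prime p → p ∣ n → ∀ e → Q (σ (p ^ e))) → Q (σ n)
σ-in-submonoid Q Q1 Q* = <-rec _ induct
  where
  Claim : ℕ → Set
  Claim n = .{{NonZero n}} → (∀ {p} → Prime p → p ∣ n → ∀ e → Q (σ (p ^ e))) → Q (σ n)
  induct : ∀ n → (∀ {m} → m < n → Claim m) → Claim n
  induct 1 _ _ = Q1
  induct n@(suc (suc _)) rec Qσ[p^e] with prime-factor n
  ... | p , p-prime , p∣n with prime-power-split p-prime n
  ... | e , m , p∤m , n≡p^e*m =
    subst Q (sym (trans (cong σ n≡p^e*m) (σ-p^e*m p-prime p∤m e)))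
      (Q* (Qσ[p^e] p-prime p∣n e) (rec m<n (λ q-prime q∣m → Qσ[p^e] q-prime (∣-trans q∣m m∣n))))
    where
    instance
      m≢0 : NonZero m
      m≢0 = ≢-nonZero λ { refl → p∤m (p ∣0) }
    m∣n : m ∣ n
    m∣n = subst (m ∣_) (sym n≡p^e*m) (n∣m*n (p ^ e))
    m<n : m < n
    m<n = ≤∧≢⇒< (∣⇒≤ m∣n) (λ m≡n → p∤m (subst (p ∣_) (sym m≡n) p∣n))

σ-*-lower-bound : ∀ k d → 1 < k → .{{NonZero d}} → 1 + k * σ d ≤ σ (k * d)
σ-*-lower-bound k d 1<k = begin
  1 + k * σ d                        ≡⟨ cong (1 +_) (sum-map-*ˡ k (divisors d)) ⟨
  sum (1 ∷ map (k *_) (divisors d))  ≤⟨ sum-mono-⊆ (1∉ ∷ Unique.map⁺ (*-cancelˡ-≡ _ _ k) (divisors-unique d))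
                                                   (∈-divisors⁺ ∘ sound) ⟩
  σ (k * d)                          ∎
  where
  open ≤-Reasoning
  instance
    k≢0 : NonZero k
    k≢0 = >-nonZero (<-trans z<s 1<k)
    kd≢0 : NonZero (k * d)
    kd≢0 = m*n≢0 k d
  1∉ : All (1 ≢_) (map (k *_) (divisors d))
  1∉ = All.tabulate λ kx∈ 1≡kx → case ∈-map⁻ (k *_) kx∈ of λ where
    (x , _ , refl) → <⇒≢ 1<k (sym (m*n≡1⇒m≡1 k x (sym 1≡kx)))
  sound : ∀ {y} → y ∈ 1 ∷ map (k *_) (divisors d) → y ∣ k * d
  sound (here refl) = 1∣ (k * d)
  sound (there y∈) with ∈-map⁻ (k *_) y∈
  ... | x , x∈ , refl = *-monoʳ-∣ k (∈-divisors⁻ x∈)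

EvenOr1Mod6 : ℕ → Set
EvenOr1Mod6 n = 2 ∣ n ⊎ n % 6 ≡ 1

EvenOr1Mod6-* : ∀ {a b} → EvenOr1Mod6 a → EvenOr1Mod6 b → EvenOr1Mod6 (a * b)
EvenOr1Mod6-* {b = b} (inj₁ 2∣a) _ = inj₁ (∣m⇒∣m*n b 2∣a)
EvenOr1Mod6-* {a} (inj₂ _) (inj₁ 2∣b) = inj₁ (∣n⇒∣m*n a 2∣b)
EvenOr1Mod6-* {a} {b} (inj₂ a≡1) (inj₂ b≡1) =
  inj₂ (trans (%-distribˡ-* a b 6) (cong₂ (λ x y → x * y % 6) a≡1 b≡1))

2∣%6⇒2∣ : ∀ {x} → 2 ∣ x % 6 → 2 ∣ x
2∣%6⇒2∣ = ∣n∣m%n⇒∣m (divides 3 refl)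

odd-residue-mod6 : ∀ x → ¬ 2 ∣ x → x % 6 ≡ 1 ⊎ x % 6 ≡ 3 ⊎ x % 6 ≡ 5
odd-residue-mod6 x 2∤x with x % 6 | m%n<n x 6 | 2∤x ∘ 2∣%6⇒2∣
... | 0 | _ | 2∤r = contradiction (2 ∣0) 2∤r
... | 1 | _ | _   = inj₁ refl
... | 2 | _ | 2∤r = contradiction ∣-refl 2∤r
... | 3 | _ | _   = inj₂ (inj₁ refl)
... | 4 | _ | 2∤r = contradiction (divides 2 refl) 2∤r
... | 5 | _ | _   = inj₂ (inj₂ refl)
... | suc (suc (suc (suc (suc (suc _))))) | s≤s (s≤s (s≤s (s≤s (s≤s (s≤s ()))))) | _

σ-p^[1+e]-mod6 : ∀ {p r s} → Prime p → ∀ e → p % 6 ≡ s → σ (p ^ e) % 6 ≡ r →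
                 σ (p ^ suc e) % 6 ≡ (1 + s * r) % 6
σ-p^[1+e]-mod6 {p} {r} {s} p-prime e p≡s σ[p^e]≡r = begin
  σ (p ^ suc e) % 6                  ≡⟨ cong (_% 6) (σ-p^[1+e] p-prime e) ⟩
  (1 + p * g) % 6                    ≡⟨ %-distribˡ-+ 1 (p * g) 6 ⟩
  (1 + p * g % 6) % 6                ≡⟨ cong (λ x → (1 + x) % 6) (%-distribˡ-* p g 6) ⟩
  (1 + p % 6 * (g % 6) % 6) % 6      ≡⟨ %-distribˡ-+ 1 (p % 6 * (g % 6)) 6 ⟨
  (1 + p % 6 * (g % 6)) % 6          ≡⟨ cong₂ (λ x y → (1 + x * y) % 6) p≡s σ[p^e]≡r ⟩
  (1 + s * r) % 6                    ∎
  where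
  open ≡-Reasoning
  g = σ (p ^ e)

σ[p^e]%6≡1∨4 : ∀ {p} → Prime p → p % 6 ≡ 3 → ∀ e → σ (p ^ e) % 6 ≡ 1 ⊎ σ (p ^ e) % 6 ≡ 4
σ[p^e]%6≡1∨4 p-prime p≡3 zero = inj₁ refl
σ[p^e]%6≡1∨4 p-prime p≡3 (suc e) with σ[p^e]%6≡1∨4 p-prime p≡3 e
... | inj₁ r≡1 = inj₂ (σ-p^[1+e]-mod6 p-prime e p≡3 r≡1)
... | inj₂ r≡4 = inj₁ (σ-p^[1+e]-mod6 p-prime e p≡3 r≡4)

σ[p^e]%6≡1∨0 : ∀ {p} → Prime p → p % 6 ≡ 5 → ∀ e → σ (p ^ e) % 6 ≡ 1 ⊎ σ (p ^ e) % 6 ≡ 0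
σ[p^e]%6≡1∨0 p-prime p≡5 zero = inj₁ refl
σ[p^e]%6≡1∨0 p-prime p≡5 (suc e) with σ[p^e]%6≡1∨0 p-prime p≡5 e
... | inj₁ r≡1 = inj₂ (σ-p^[1+e]-mod6 p-prime e p≡5 r≡1)
... | inj₂ r≡0 = inj₁ (σ-p^[1+e]-mod6 p-prime e p≡5 r≡0)

σ-p^e-EvenOr1Mod6 : ∀ {p} → Prime p → p % 6 ≡ 3 ⊎ p % 6 ≡ 5 → ∀ e → EvenOr1Mod6 (σ (p ^ e))
σ-p^e-EvenOr1Mod6 p-prime (inj₁ p≡3) e with σ[p^e]%6≡1∨4 p-prime p≡3 e
... | inj₁ r≡1 = inj₂ r≡1
... | inj₂ r≡4 = inj₁ (2∣%6⇒2∣ (subst (2 ∣_) (sym r≡4) (divides 2 refl)))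
σ-p^e-EvenOr1Mod6 p-prime (inj₂ p≡5) e with σ[p^e]%6≡1∨0 p-prime p≡5 e
... | inj₁ r≡1 = inj₂ r≡1
... | inj₂ r≡0 = inj₁ (2∣%6⇒2∣ (subst (2 ∣_) (sym r≡0) (2 ∣0)))

friendOf10-¬10∣ : ∀ {N} → FriendOf10 N → ¬ 10 ∣ N
friendOf10-¬10∣ (10<N , 5σN≡9N) (divides k refl) = <-irrefl (sym 5σN≡9N) (begin-strict
  9 * (k * 10)           ≡⟨ *-comm 9 (k * 10) ⟩
  k * 10 * 9             ≡⟨ *-assoc k 10 9 ⟩
  k * 90                 ≡⟨ *-assoc k 18 5 ⟨
  k * 18 * 5             ≡⟨ *-comm (k * 18) 5 ⟩
  5 * (k * 18)           <⟨ *-monoʳ-< 5 (n<1+n (k * 18)) ⟩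
  5 * (1 + k * 18)       ≡⟨⟩
  5 * (1 + k * σ 10)     ≤⟨ *-monoʳ-≤ 5 (σ-*-lower-bound k 10 (*-cancelʳ-< 10 1 k 10<N)) ⟩
  5 * σ (k * 10)         ∎)
  where open ≤-Reasoning

friendOf10-odd : ∀ {N} → FriendOf10 N → ¬ 2 ∣ N
friendOf10-odd {N} friend@(_ , 5σN≡9N) 2∣N = friendOf10-¬10∣ friend (lcm-least 2∣N 5∣N)
  where
  5∣N : 5 ∣ N
  5∣N = prime∤m⇒∣m*n⇒∣n (from-yes (prime? 5)) (from-no (5 ∣? 9))
          (divides (σ N) (trans (sym 5σN≡9N) (*-comm 5 (σ N))))

friendOf10-σ : ∀ {N} → FriendOf10 N → ¬ EvenOr1Mod6 (σ N)
friendOf10-σ {N} friend@(_ , 5σN≡9N) (inj₁ 2∣σN) =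
  friendOf10-odd friend (prime∤m⇒∣m*n⇒∣n (from-yes (prime? 2)) (from-no (2 ∣? 9))
    (subst (2 ∣_) 5σN≡9N (∣n⇒∣m*n 5 2∣σN)))
friendOf10-σ {N} (_ , 5σN≡9N) (inj₂ σN≡1) = contradiction 3∣1 (from-no (3 ∣? 1))
  where
  3∣σN : 3 ∣ σ N
  3∣σN = prime∤m⇒∣m*n⇒∣n (from-yes (prime? 3)) (from-no (3 ∣? 5))
           (subst (3 ∣_) (sym 5σN≡9N) (∣m⇒∣m*n N (divides 3 refl)))
  3∣1 : 3 ∣ 1
  3∣1 = subst (3 ∣_) σN≡1 (%-presˡ-∣ 3∣σN (divides 2 refl))

prime-factor≡1-mod6⊎σ-EvenOr1Mod6 : ∀ N → .{{NonZero N}} → ¬ 2 ∣ N →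
                                    (∃ λ p → Prime p × p ∣ N × p % 6 ≡ 1) ⊎ EvenOr1Mod6 (σ N)
prime-factor≡1-mod6⊎σ-EvenOr1Mod6 N N-odd
  with anyUpTo? (λ p → prime? p ×-dec p ∣? N ×-dec p % 6 ≟ 1) (suc N)
... | yes (p , _ , p-witness) = inj₁ (p , p-witness)
... | no no-witness = inj₂ (σ-in-submonoid EvenOr1Mod6 (inj₂ refl) EvenOr1Mod6-* N σ[p^e]-good)
  where
  σ[p^e]-good : ∀ {p} → Prime p → p ∣ N → ∀ e → EvenOr1Mod6 (σ (p ^ e))
  σ[p^e]-good {p} p-prime p∣N with odd-residue-mod6 p (N-odd ∘ (λ 2∣p → ∣-trans 2∣p p∣N))
  ... | inj₁ p≡1 = contradiction (p , s≤s (∣⇒≤ p∣N) , p-prime , p∣N , p≡1) no-witness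
  ... | inj₂ p≡3∨5 = σ-p^e-EvenOr1Mod6 p-prime p≡3∨5

corollary1p8 : (N : ℕ) → FriendOf10 N → ∃ λ p → Prime p × p ∣ N × p % 6 ≡ 1
corollary1p8 N friend@(10<N , _) =
  [ id , ⊥-elim ∘ friendOf10-σ friend ]′ (prime-factor≡1-mod6⊎σ-EvenOr1Mod6 N (friendOf10-odd friend))
  where
  instance
    N≢0 : NonZero N
    N≢0 = >-nonZero (<-trans z<s 10<N)
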